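{- Let $m,q$ be positive integers. Let $\widetilde{\bm F}_{m,q}=(d_{n,k})_{n,k\ge0}$ be the infinite lower triangular matrix with $d_{0,0}=m/q$, $d_{0,k}=0$ for $k\ge1$, and, for $n\ge1$, $(d_{n,0},\ldots,d_{n,n})$ equal to the extended $f$-vector $(f_{ -1},f_0,\ldots,f_{n-1})$ of $\Delta^{(n-1)}_{m,q}$ and $d_{n,k}=0$ for $k>n$ (so $d_{n,k}$ is the number of $(k-1)$-dimensional faces of $\Delta^{(n-1)}_{m,q}$). Then $$\widetilde{\bm F}_{m,q}=T\!\left(\frac{m+(q-m)x}{q^2}\,\Big|\,\frac{1-x}{q}\right).$$
   Context: $[k]$ denotes the $0$-dimensional simplicial complex with $k$ vertices; the join is $\mathcal F*\mathcal K=\{\sigma\cup\tau:\sigma\in\mathcal F\cup\{\emptyset\},\tau\in\mathcal K\cup\{\emptyset\}\}$ on disjoint vertex sets. $\Delta^{(0)}_{m,q}=[m]$ and $\Delta^{(n)}_{m,q}=\Delta^{(n-1)}_{m,q}*[q]$ for $n\ge1$. The extended $f$-vector of a $d$-dimensional complex is $(f_{ -1},f_0,\ldots,f_d)$ with $f_{ -1}=1$ and $f_k$ the number of $k$-dimensional faces. For $\alpha,\omega\in\mathbb C[[x]]$ with $\alpha(0),\omega(0)\ne0$, $T(\alpha\mid\omega)=(d_{ij})$ with $d_{ij}=[x^i]\,x^j\alpha(x)/\omega(x)^{j+1}$. -}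

module Defs where

open import Data.Nat as ℕ using (ℕ; zero; suc; _∸_; _≡ᵇ_; _≤ᵇ_)
open import Data.Integer as ℤ using (ℤ)
open import Data.Rational as ℚ using (ℚ; 0ℚ; 1ℚ; _+_; _*_; -_; 1/_; NonZero)
open import Data.Rational.Properties using (normalize-pos; pos⇒nonZero)
open import Data.List as List using (List; []; _∷_; _++_; map; concatMap; length; filter; upTo)
open import Data.Bool using (Bool; true; false; if_then_else_; T)
open import Relation.Nullary.Decidable using (T?)
open import Function using (_∘_)

-- Simplicial complexes (finite, on vertex labels in ℕ)
-- A complex 𝓕 is represented by the list of ALL its faces INCLUDING the
-- empty face, i.e. by 𝓕 ∪ {∅}; each face is the list of its vertices.

Face : Set
Face = List ℕ

Complex : Set
Complex = List Face

pts : ℕ → Complex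
pts k = [] ∷ map (λ i → i ∷ []) (upTo k)

shift : ℕ → Face → Face
shift o = map (o ℕ.+_)

-- join 𝓕 * 𝓚 where the vertices of 𝓚 are shifted by o (chosen larger
-- than every vertex of 𝓕, so the vertex sets are disjoint):
-- faces are σ ∪ τ with σ ∈ 𝓕 ∪ {∅}, τ ∈ 𝓚 ∪ {∅}.
join : Complex → ℕ → Complex → Complex
join F o K = concatMap (λ σ → map (λ τ → σ ++ shift o τ) K) F

-- Δ^{(n)}_{m,q} : Δ^{(0)} = [m], Δ^{(n+1)} = Δ^{(n)} * [q].
-- Δ^{(n)} uses vertices 0 … m + n q - 1.
Δ : ℕ → ℕ → ℕ → Complex
Δ m q zero    = pts m
Δ m q (suc n) = join (Δ m q n) (m ℕ.+ n ℕ.* q) (pts q)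

-- number of faces with exactly k vertices (= f_{k-1}; k = 0 gives f_{-1})
faces# : Complex → ℕ → ℕ
faces# C k = length (filter (λ σ → T? (length σ ≡ᵇ k)) C)

ℕ→ℚ : ℕ → ℚ
ℕ→ℚ n = ℤ.+ n ℚ./ 1

ℤ→ℚ : ℤ → ℚ
ℤ→ℚ z = z ℚ./ 1

inv : (q : ℕ) → .{{ℕ.NonZero q}} → ℚ
inv q = ℤ.+ 1 ℚ./ q

inv-nonZero : (q : ℕ) → .{{_ : ℕ.NonZero q}} → NonZero (inv q)
inv-nonZero q = pos⇒nonZero (inv q) {{normalize-pos 1 q}}

Ftilde : (m q : ℕ) → .{{ℕ.NonZero q}} → ℕ → ℕ → ℚ
Ftilde m q zero zero       = ℕ→ℚ m * inv q
Ftilde m q zero (suc k)    = 0ℚ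
Ftilde m q (suc n) k with k ≤ᵇ suc n
... | true  = ℕ→ℚ (faces# (Δ m q n) k)
... | false = 0ℚ

Series : Set
Series = ℕ → ℚ

Σ< : ℕ → (ℕ → ℚ) → ℚ
Σ< zero    f = 0ℚ
Σ< (suc n) f = Σ< n f + f n

_⊛_ : Series → Series → Series
(a ⊛ b) n = Σ< (suc n) (λ i → a i * b (n ∸ i))

oneS : Series
oneS zero    = 1ℚ
oneS (suc _) = 0ℚ

X^ : ℕ → Series
X^ j n = if j ≡ᵇ n then 1ℚ else 0ℚ

_^S_ : Series → ℕ → Series
s ^S zero  = oneS
s ^S suc k = s ⊛ (s ^S k)

-- multiplicative inverse of a series with nonzero constant term:
-- c₀ = 1/ω₀,  c_n = -(1/ω₀) Σ_{k=1}^{n} ω_k c_{n-k}.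
module _ (ω : Series) .{{nz : NonZero (ω 0)}} where
  private
    -- invUpTo n i is the correct coefficient c_i whenever i ≤ n
    invUpTo : ℕ → Series
    invUpTo zero    = λ _ → 1/ (ω 0)
    invUpTo (suc n) i =
      if i ≤ᵇ n then invUpTo n i
      else - (1/ (ω 0)) * Σ< (suc n) (λ k → ω (suc k) * invUpTo n (n ∸ k))

  invS : Series
  invS n = invUpTo n n

Tmat : (α ω : Series) → .{{NonZero (ω 0)}} → ℕ → ℕ → ℚ
Tmat α ω i j = ((X^ j ⊛ α) ⊛ (invS ω ^S suc j)) i

αmq : (m q : ℕ) → .{{ℕ.NonZero q}} → Series
αmq m q zero          = ℕ→ℚ m * (inv q * inv q)
αmq m q (suc zero)    = ℤ→ℚ (ℤ.+ q ℤ.- ℤ.+ m) * (inv q * inv q)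
αmq m q (suc (suc _)) = 0ℚ

ωq : (q : ℕ) → .{{ℕ.NonZero q}} → Series
ωq q zero          = inv q
ωq q (suc zero)    = - inv q
ωq q (suc (suc _)) = 0ℚ

-- Both matrices satisfy the Pascal-type recurrence d(n+1,k+1) = d(n,k+1) + q d(n,k) and have the
-- same first row and first column, hence coincide. For F̃ the recurrence is the f-vector of a join
-- with q points: a face of F * [q] is a face of F, possibly plus one of the q new vertices. For T the
-- series 1/ω = q/(1-x) has all coefficients q, so multiplying by it takes q times prefix sums, and
-- x^(k+1) α is x^k α shifted by one.
module Submission where

open import Defs
open import Data.Nat as ℕ using (ℕ; NonZero; zero; suc; _∸_; _≡ᵇ_; _≤ᵇ_; _<_)
import Data.Nat.Properties as ℕₚ
import Data.Nat.Solver as ℕ-Solver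
open import Data.Integer as ℤ using (ℤ)
import Data.Integer.Properties as ℤₚ
open import Data.Rational as ℚ using (ℚ; mkℚ; 0ℚ; 1ℚ; _+_; _*_; -_; 1/_)
import Data.Rational.Properties as ℚₚ
import Data.Rational.Solver as ℚ-Solver
import Data.Nat.Coprimality as Coprimality
open import Data.Bool using (Bool; true; false; T; if_then_else_)
open import Data.List using ([]; _∷_; [_]; _++_; map; length; filter; upTo)
import Data.List.Properties as Listₚ
open import Relation.Nullary.Decidable using (T?)
open import Relation.Binary.PropositionalEquality
  using (_≡_; refl; sym; trans; cong; cong₂; subst; _≗_; module ≡-Reasoning)
open import Function using (_∘_; id; const)

open ≡-Reasoning

Σ<-cong : ∀ n {f g : ℕ → ℚ} → (∀ i → i < n → f i ≡ g i) → Σ< n f ≡ Σ< n g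
Σ<-cong zero    _   = refl
Σ<-cong (suc n) f≡g = cong₂ _+_ (Σ<-cong n (λ i i<n → f≡g i (ℕₚ.m<n⇒m<1+n i<n))) (f≡g n ℕₚ.≤-refl)

Σ<-zeros : ∀ n {f : ℕ → ℚ} → (∀ i → i < n → f i ≡ 0ℚ) → Σ< n f ≡ 0ℚ
Σ<-zeros zero    _   = refl
Σ<-zeros (suc n) f≡0 = trans
  (cong₂ _+_ (Σ<-zeros n (λ i i<n → f≡0 i (ℕₚ.m<n⇒m<1+n i<n))) (f≡0 n ℕₚ.≤-refl))
  (ℚₚ.+-identityˡ 0ℚ)

Σ<-head : ∀ n (f : ℕ → ℚ) → Σ< (suc n) f ≡ f 0 + Σ< n (f ∘ suc)
Σ<-head zero    f = trans (ℚₚ.+-identityˡ (f 0)) (sym (ℚₚ.+-identityʳ (f 0)))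
Σ<-head (suc n) f = trans (cong (_+ f (suc n)) (Σ<-head n f)) (ℚₚ.+-assoc (f 0) _ _)

Σ<-distrib-+ : ∀ n (f g : ℕ → ℚ) → Σ< n (λ i → f i + g i) ≡ Σ< n f + Σ< n g
Σ<-distrib-+ zero    f g = sym (ℚₚ.+-identityˡ 0ℚ)
Σ<-distrib-+ (suc n) f g = trans (cong (_+ (f n + g n)) (Σ<-distrib-+ n f g))
  (solve 4 (λ a b c d → (a :+ b) :+ (c :+ d) := (a :+ c) :+ (b :+ d)) refl
     (Σ< n f) (Σ< n g) (f n) (g n))
  where open ℚ-Solver.+-*-Solver

*-distribˡ-Σ< : ∀ n c (f : ℕ → ℚ) → c * Σ< n f ≡ Σ< n (λ i → c * f i)
*-distribˡ-Σ< zero    c f = ℚₚ.*-zeroʳ c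
*-distribˡ-Σ< (suc n) c f = trans (ℚₚ.*-distribˡ-+ c _ _) (cong (_+ c * f n) (*-distribˡ-Σ< n c f))

⊛-0 : ∀ (a b : Series) → (a ⊛ b) 0 ≡ a 0 * b 0
⊛-0 a b = ℚₚ.+-identityˡ (a 0 * b 0)

⊛-0-zeroˡ : ∀ {a : Series} (b : Series) → a 0 ≡ 0ℚ → (a ⊛ b) 0 ≡ 0ℚ
⊛-0-zeroˡ {a} b a₀≡0 = trans (⊛-0 a b) (trans (cong (_* b 0) a₀≡0) (ℚₚ.*-zeroˡ (b 0)))

⊛-suc-last : ∀ (a b : Series) n →
             (a ⊛ b) (suc n) ≡ Σ< (suc n) (λ i → a i * b (suc n ∸ i)) + a (suc n) * b 0
⊛-suc-last a b n = cong (λ j → Σ< (suc n) (λ i → a i * b (suc n ∸ i)) + a (suc n) * b j) (ℕₚ.n∸n≡0 n)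

⊛-suc-head : ∀ (a b : Series) n → (a ⊛ b) (suc n) ≡ a 0 * b (suc n) + ((a ∘ suc) ⊛ b) n
⊛-suc-head a b n = Σ<-head (suc n) (λ i → a i * b (suc n ∸ i))

⊛-identityʳ : ∀ (a : Series) n → (a ⊛ oneS) n ≡ a n
⊛-identityʳ a n = begin
  Σ< n (λ i → a i * oneS (n ∸ i)) + a n * oneS (n ∸ n)
    ≡⟨ cong₂ _+_ (Σ<-zeros n a*oneS≡0) (cong (λ j → a n * oneS j) (ℕₚ.n∸n≡0 n)) ⟩
  0ℚ + a n * 1ℚ
    ≡⟨ trans (ℚₚ.+-identityˡ _) (ℚₚ.*-identityʳ (a n)) ⟩
  a n ∎
  where
  oneS-pos : ∀ {j} → 0 < j → oneS j ≡ 0ℚ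
  oneS-pos {suc _} _ = refl

  a*oneS≡0 : ∀ i → i < n → a i * oneS (n ∸ i) ≡ 0ℚ
  a*oneS≡0 i i<n = trans (cong (a i *_) (oneS-pos (ℕₚ.m<n⇒0<n∸m i<n))) (ℚₚ.*-zeroʳ (a i))

X^0-⊛ : ∀ (a : Series) n → (X^ 0 ⊛ a) n ≡ a n
X^0-⊛ a n = begin
  (X^ 0 ⊛ a) n
    ≡⟨ Σ<-head n _ ⟩
  1ℚ * a (n ∸ 0) + Σ< n (λ i → 0ℚ * a (n ∸ suc i))
    ≡⟨ cong₂ _+_ (ℚₚ.*-identityˡ (a n)) (Σ<-zeros n (λ i _ → ℚₚ.*-zeroˡ (a (n ∸ suc i)))) ⟩
  a n + 0ℚ
    ≡⟨ ℚₚ.+-identityʳ (a n) ⟩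
  a n ∎

⊛-shiftˡ : ∀ {a a′ : Series} (b : Series) → a 0 ≡ 0ℚ → a ∘ suc ≗ a′ → ∀ n → (a ⊛ b) (suc n) ≡ (a′ ⊛ b) n
⊛-shiftˡ {a} {a′} b a₀≡0 a∘suc≗a′ n = begin
  (a ⊛ b) (suc n)                      ≡⟨ ⊛-suc-head a b n ⟩
  a 0 * b (suc n) + ((a ∘ suc) ⊛ b) n  ≡⟨ cong₂ _+_ (trans (cong (_* b (suc n)) a₀≡0) (ℚₚ.*-zeroˡ (b (suc n))))
                                                    (Σ<-cong (suc n) (λ i _ → cong (_* b (n ∸ i)) (a∘suc≗a′ i))) ⟩
  0ℚ + (a′ ⊛ b) n                      ≡⟨ ℚₚ.+-identityˡ _ ⟩
  (a′ ⊛ b) n                           ∎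

module ConstantSeries (c : Series) (Q : ℚ) (c≗Q : c ≗ const Q) where

  c⊛-0 : ∀ t → (c ⊛ t) 0 ≡ Q * t 0
  c⊛-0 t = trans (⊛-0 c t) (cong (_* t 0) (c≗Q 0))

  c⊛-suc : ∀ t n → (c ⊛ t) (suc n) ≡ Q * t (suc n) + (c ⊛ t) n
  c⊛-suc t n = trans (⊛-suc-head c t n) (cong₂ _+_ (cong (_* t (suc n)) (c≗Q 0))
    (Σ<-cong (suc n) (λ i _ → cong (_* t (n ∸ i)) (trans (c≗Q (suc i)) (sym (c≗Q i))))))

  ⊛-c⊛-0 : ∀ s t → (s ⊛ (c ⊛ t)) 0 ≡ Q * (s ⊛ t) 0
  ⊛-c⊛-0 s t = begin
    (s ⊛ (c ⊛ t)) 0  ≡⟨ ⊛-0 s (c ⊛ t) ⟩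
    s 0 * (c ⊛ t) 0  ≡⟨ cong (s 0 *_) (c⊛-0 t) ⟩
    s 0 * (Q * t 0)  ≡⟨ solve 3 (λ a q b → a :* (q :* b) := q :* (a :* b)) refl (s 0) Q (t 0) ⟩
    Q * (s 0 * t 0)  ≡⟨ cong (Q *_) (⊛-0 s t) ⟨
    Q * (s ⊛ t) 0    ∎
    where open ℚ-Solver.+-*-Solver

  ⊛-c⊛-suc : ∀ s t n → (s ⊛ (c ⊛ t)) (suc n) ≡ (s ⊛ (c ⊛ t)) n + Q * (s ⊛ t) (suc n)
  ⊛-c⊛-suc s t n = begin
    (s ⊛ u) (suc n)
      ≡⟨ ⊛-suc-last s u n ⟩
    Σ< (suc n) (λ i → s i * u (suc n ∸ i)) + s (suc n) * u 0
      ≡⟨ cong₂ _+_ split-sum (cong (s (suc n) *_) (c⊛-0 t)) ⟩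
    (Q * S + (s ⊛ u) n) + s (suc n) * (Q * t 0)
      ≡⟨ solve 5 (λ q a b x y → (q :* a :+ b) :+ x :* (q :* y) := b :+ q :* (a :+ x :* y))
               refl Q S ((s ⊛ u) n) (s (suc n)) (t 0) ⟩
    (s ⊛ u) n + Q * (S + s (suc n) * t 0)
      ≡⟨ cong (λ z → (s ⊛ u) n + Q * z) (⊛-suc-last s t n) ⟨
    (s ⊛ u) n + Q * (s ⊛ t) (suc n) ∎
    where
    open ℚ-Solver.+-*-Solver
    u = c ⊛ t
    S = Σ< (suc n) (λ i → s i * t (suc n ∸ i))

    suc-∸ : ∀ i → i < suc n → suc n ∸ i ≡ suc (n ∸ i)
    suc-∸ i i<1+n = ℕₚ.+-∸-assoc 1 (ℕₚ.≤-pred i<1+n)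

    split-term : ∀ i → i < suc n → s i * u (suc n ∸ i) ≡ Q * (s i * t (suc n ∸ i)) + s i * u (n ∸ i)
    split-term i i<1+n = begin
      s i * u (suc n ∸ i)                          ≡⟨ cong (λ j → s i * u j) (suc-∸ i i<1+n) ⟩
      s i * u (suc (n ∸ i))                        ≡⟨ cong (s i *_) (c⊛-suc t (n ∸ i)) ⟩
      s i * (Q * t (suc (n ∸ i)) + u (n ∸ i))      ≡⟨ cong (λ j → s i * (Q * t j + u (n ∸ i))) (suc-∸ i i<1+n) ⟨
      s i * (Q * t (suc n ∸ i) + u (n ∸ i))        ≡⟨ solve 4 (λ a q x y → a :* (q :* x :+ y) := q :* (a :* x) :+ a :* y)
                                                             refl (s i) Q (t (suc n ∸ i)) (u (n ∸ i)) ⟩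
      Q * (s i * t (suc n ∸ i)) + s i * u (n ∸ i)  ∎

    split-sum : Σ< (suc n) (λ i → s i * u (suc n ∸ i)) ≡ Q * S + (s ⊛ u) n
    split-sum = begin
      Σ< (suc n) (λ i → s i * u (suc n ∸ i))                          ≡⟨ Σ<-cong (suc n) split-term ⟩
      Σ< (suc n) (λ i → Q * (s i * t (suc n ∸ i)) + s i * u (n ∸ i))  ≡⟨ Σ<-distrib-+ (suc n) _ _ ⟩
      Σ< (suc n) (λ i → Q * (s i * t (suc n ∸ i))) + (s ⊛ u) n        ≡⟨ cong (_+ (s ⊛ u) n) (*-distribˡ-Σ< (suc n) Q _) ⟨
      Q * S + (s ⊛ u) n                                               ∎

PascalRecurrence : ℚ → (ℕ → ℕ → ℚ) → Set
PascalRecurrence Q d = ∀ n k → d (suc n) (suc k) ≡ d n (suc k) + Q * d n k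

pascal-unique : ∀ {Q d e} → PascalRecurrence Q d → PascalRecurrence Q e →
                (∀ k → d 0 k ≡ e 0 k) → (∀ n → d (suc n) 0 ≡ e (suc n) 0) →
                ∀ n k → d n k ≡ e n k
pascal-unique _ _ row₀ _ zero k = row₀ k
pascal-unique _ _ _ column₀ (suc n) zero = column₀ n
pascal-unique {Q} {d} {e} d-rec e-rec row₀ column₀ (suc n) (suc k) = begin
  d (suc n) (suc k)        ≡⟨ d-rec n k ⟩
  d n (suc k) + Q * d n k  ≡⟨ cong₂ (λ a b → a + Q * b) (d≡e n (suc k)) (d≡e n k) ⟩
  e n (suc k) + Q * e n k  ≡⟨ e-rec n k ⟨
  e (suc n) (suc k)        ∎
  where d≡e = pascal-unique {Q} {d} {e} d-rec e-rec row₀ column₀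

module _ (ω : Series) .{{_ : ℚ.NonZero (ω 0)}} (Q : ℚ) (invS≗Q : invS ω ≗ const Q) (α : Series) where
  open ConstantSeries (invS ω) Q invS≗Q

  private
    xᵏα : ℕ → Series
    xᵏα k = X^ k ⊛ α

    xᵏ⁺¹α-0 : ∀ k → xᵏα (suc k) 0 ≡ 0ℚ
    xᵏ⁺¹α-0 k = ⊛-0-zeroˡ {X^ (suc k)} α refl

    xᵏ⁺¹α-suc : ∀ k → xᵏα (suc k) ∘ suc ≗ xᵏα k
    xᵏ⁺¹α-suc k = ⊛-shiftˡ {X^ (suc k)} {X^ k} α refl (λ _ → refl)

  Tmat-0-0 : Tmat α ω 0 0 ≡ Q * α 0
  Tmat-0-0 = trans (⊛-c⊛-0 (xᵏα 0) oneS) (cong (Q *_) (trans (⊛-identityʳ (xᵏα 0) 0) (X^0-⊛ α 0)))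

  Tmat-0-suc : ∀ k → Tmat α ω 0 (suc k) ≡ 0ℚ
  Tmat-0-suc k = ⊛-0-zeroˡ {xᵏα (suc k)} (invS ω ^S suc (suc k)) (xᵏ⁺¹α-0 k)

  Tmat-suc-0 : ∀ n → Tmat α ω (suc n) 0 ≡ Tmat α ω n 0 + Q * α (suc n)
  Tmat-suc-0 n = trans (⊛-c⊛-suc (xᵏα 0) oneS n)
    (cong (λ z → Tmat α ω n 0 + Q * z) (trans (⊛-identityʳ (xᵏα 0) (suc n)) (X^0-⊛ α (suc n))))

  Tmat-pascal : PascalRecurrence Q (Tmat α ω)
  Tmat-pascal n k = trans (⊛-c⊛-suc (xᵏα (suc k)) (invS ω ^S suc k) n)
    (cong (λ z → Tmat α ω n (suc k) + Q * z) (⊛-shiftˡ {xᵏα (suc k)} {xᵏα k} (invS ω ^S suc k) (xᵏ⁺¹α-0 k) (xᵏ⁺¹α-suc k) n))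

iverson : Bool → ℕ
iverson true  = 1
iverson false = 0

faces#-∷ : ∀ σ C k → faces# (σ ∷ C) k ≡ iverson (length σ ≡ᵇ k) ℕ.+ faces# C k
faces#-∷ σ C k with length σ ≡ᵇ k
... | true  = refl
... | false = refl

faces#-++ : ∀ C D k → faces# (C ++ D) k ≡ faces# C k ℕ.+ faces# D k
faces#-++ C D k = trans (cong length (Listₚ.filter-++ (λ σ → T? (length σ ≡ᵇ k)) C D)) (Listₚ.length-++ (filter _ C))

faces#-map-pts : ∀ (f : Face → Face) ℓ → (∀ τ → length (f τ) ≡ ℓ ℕ.+ length τ) →
                 ∀ q k → faces# (map f (pts q)) k ≡ iverson (ℓ ≡ᵇ k) ℕ.+ q ℕ.* iverson (suc ℓ ≡ᵇ k)
faces#-map-pts f ℓ ∣f∣ q k = begin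
  faces# (map f (pts q)) k
    ≡⟨ faces#-∷ (f []) _ k ⟩
  iverson (length (f []) ≡ᵇ k) ℕ.+ faces# (map f (map [_] (upTo q))) k
    ≡⟨ cong₂ (λ l c → iverson (l ≡ᵇ k) ℕ.+ c) (trans (∣f∣ []) (ℕₚ.+-identityʳ ℓ)) (vertices (upTo q)) ⟩
  iverson (ℓ ≡ᵇ k) ℕ.+ length (upTo q) ℕ.* iverson (suc ℓ ≡ᵇ k)
    ≡⟨ cong (λ l → iverson (ℓ ≡ᵇ k) ℕ.+ l ℕ.* iverson (suc ℓ ≡ᵇ k)) (Listₚ.length-upTo q) ⟩
  iverson (ℓ ≡ᵇ k) ℕ.+ q ℕ.* iverson (suc ℓ ≡ᵇ k) ∎
  where
  vertices : ∀ is → faces# (map f (map [_] is)) k ≡ length is ℕ.* iverson (suc ℓ ≡ᵇ k)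
  vertices []       = refl
  vertices (i ∷ is) = trans (faces#-∷ (f [ i ]) _ k)
    (cong₂ (λ l c → iverson (l ≡ᵇ k) ℕ.+ c) (trans (∣f∣ [ i ]) (ℕₚ.+-comm ℓ 1)) (vertices is))

faces#-pts : ∀ m k → faces# (pts m) k ≡ iverson (0 ≡ᵇ k) ℕ.+ m ℕ.* iverson (1 ≡ᵇ k)
faces#-pts m k = trans (cong (λ C → faces# C k) (sym (Listₚ.map-id (pts m)))) (faces#-map-pts id 0 (λ _ → refl) m k)

module _ (o q : ℕ) where
  private
    cone : Face → Complex
    cone σ = map (λ τ → σ ++ shift o τ) (pts q)

    faces#-cone : ∀ σ k → faces# (cone σ) k ≡ iverson (length σ ≡ᵇ k) ℕ.+ q ℕ.* iverson (suc (length σ) ≡ᵇ k)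
    faces#-cone σ = faces#-map-pts (λ τ → σ ++ shift o τ) (length σ)
      (λ τ → trans (Listₚ.length-++ σ) (cong (length σ ℕ.+_) (Listₚ.length-map (o ℕ.+_) τ))) q

  faces#-join-pts-0 : ∀ F → faces# (join F o (pts q)) 0 ≡ faces# F 0
  faces#-join-pts-0 []      = refl
  faces#-join-pts-0 (σ ∷ F) = begin
    faces# (cone σ ++ join F o (pts q)) 0                        ≡⟨ faces#-++ (cone σ) _ 0 ⟩
    faces# (cone σ) 0 ℕ.+ faces# (join F o (pts q)) 0             ≡⟨ cong₂ ℕ._+_ (faces#-cone σ 0) (faces#-join-pts-0 F) ⟩
    iverson (length σ ≡ᵇ 0) ℕ.+ q ℕ.* 0 ℕ.+ faces# F 0            ≡⟨ cong (λ z → iverson (length σ ≡ᵇ 0) ℕ.+ z ℕ.+ faces# F 0) (ℕₚ.*-zeroʳ q) ⟩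
    iverson (length σ ≡ᵇ 0) ℕ.+ 0 ℕ.+ faces# F 0                  ≡⟨ cong (ℕ._+ faces# F 0) (ℕₚ.+-identityʳ _) ⟩
    iverson (length σ ≡ᵇ 0) ℕ.+ faces# F 0                        ≡⟨ faces#-∷ σ F 0 ⟨
    faces# (σ ∷ F) 0                                              ∎

  faces#-join-pts-suc : ∀ F k → faces# (join F o (pts q)) (suc k) ≡ faces# F (suc k) ℕ.+ q ℕ.* faces# F k
  faces#-join-pts-suc []      k = sym (ℕₚ.*-zeroʳ q)
  faces#-join-pts-suc (σ ∷ F) k = begin
    faces# (cone σ ++ join F o (pts q)) (suc k)                 ≡⟨ faces#-++ (cone σ) _ (suc k) ⟩
    faces# (cone σ) (suc k) ℕ.+ faces# (join F o (pts q)) (suc k) ≡⟨ cong₂ ℕ._+_ (faces#-cone σ (suc k)) (faces#-join-pts-suc F k) ⟩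
    a ℕ.+ q ℕ.* b ℕ.+ (c ℕ.+ q ℕ.* d)                            ≡⟨ solve 5 (λ a b c d q → a :+ q :* b :+ (c :+ q :* d) := a :+ c :+ q :* (b :+ d))
                                                                        refl a b c d q ⟩
    a ℕ.+ c ℕ.+ q ℕ.* (b ℕ.+ d)                                  ≡⟨ cong₂ (λ u v → u ℕ.+ q ℕ.* v) (faces#-∷ σ F (suc k)) (faces#-∷ σ F k) ⟨
    faces# (σ ∷ F) (suc k) ℕ.+ q ℕ.* faces# (σ ∷ F) k            ∎
    where
    open ℕ-Solver.+-*-Solver
    a = iverson (length σ ≡ᵇ suc k)
    b = iverson (length σ ≡ᵇ k)
    c = faces# F (suc k)
    d = faces# F k

module _ (m q : ℕ) where

  faces#-Δ-0 : ∀ n → faces# (Δ m q n) 0 ≡ 1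
  faces#-Δ-0 zero    = trans (faces#-pts m 0) (cong suc (ℕₚ.*-zeroʳ m))
  faces#-Δ-0 (suc n) = trans (faces#-join-pts-0 _ q (Δ m q n)) (faces#-Δ-0 n)

  faces#-Δ-suc : ∀ n k → faces# (Δ m q (suc n)) (suc k) ≡ faces# (Δ m q n) (suc k) ℕ.+ q ℕ.* faces# (Δ m q n) k
  faces#-Δ-suc n = faces#-join-pts-suc _ q (Δ m q n)

  faces#-Δ₀-1 : faces# (Δ m q 0) 1 ≡ m
  faces#-Δ₀-1 = trans (faces#-pts m 1) (ℕₚ.*-identityʳ m)

  faces#-Δ-vanish : ∀ n j → suc n < j → faces# (Δ m q n) j ≡ 0
  faces#-Δ-vanish zero    (suc zero)    (ℕ.s≤s ())
  faces#-Δ-vanish zero    (suc (suc j)) _           = trans (faces#-pts m (suc (suc j))) (ℕₚ.*-zeroʳ m)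
  faces#-Δ-vanish (suc n) (suc j)       (ℕ.s≤s n<j) = begin
    faces# (Δ m q (suc n)) (suc j)                          ≡⟨ faces#-Δ-suc n j ⟩
    faces# (Δ m q n) (suc j) ℕ.+ q ℕ.* faces# (Δ m q n) j   ≡⟨ cong₂ (λ a b → a ℕ.+ q ℕ.* b)
                                                                  (faces#-Δ-vanish n (suc j) (ℕₚ.m<n⇒m<1+n n<j)) (faces#-Δ-vanish n j n<j) ⟩
    0 ℕ.+ q ℕ.* 0                                           ≡⟨ ℕₚ.*-zeroʳ q ⟩
    0                                                       ∎

instance
  inv-nonZero-instance : ∀ {q} .{{_ : NonZero q}} → ℚ.NonZero (inv q)
  inv-nonZero-instance {q} = inv-nonZero q

-- On these normal forms _+_ and _*_ of ℚ compute, which yields the homomorphism laws below.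
ℤ→ℚ≡mkℚ : ∀ z → ℤ→ℚ z ≡ mkℚ z 0 (Coprimality.sym (Coprimality.1-coprimeTo ℤ.∣ z ∣))
ℤ→ℚ≡mkℚ z = ℚₚ.↥p/↧p≡p (mkℚ z 0 _)

ℤ→ℚ-+ : ∀ a b → ℤ→ℚ (a ℤ.+ b) ≡ ℤ→ℚ a + ℤ→ℚ b
ℤ→ℚ-+ a b = sym (trans (cong₂ _+_ (ℤ→ℚ≡mkℚ a) (ℤ→ℚ≡mkℚ b))
  (cong (ℚ._/ 1) (cong₂ ℤ._+_ (ℤₚ.*-identityʳ a) (ℤₚ.*-identityʳ b))))

ℤ→ℚ-* : ∀ a b → ℤ→ℚ (a ℤ.* b) ≡ ℤ→ℚ a * ℤ→ℚ b
ℤ→ℚ-* a b = sym (cong₂ _*_ (ℤ→ℚ≡mkℚ a) (ℤ→ℚ≡mkℚ b))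

ℕ→ℚ-+ : ∀ a b → ℕ→ℚ (a ℕ.+ b) ≡ ℕ→ℚ a + ℕ→ℚ b
ℕ→ℚ-+ a b = ℤ→ℚ-+ (ℤ.+ a) (ℤ.+ b)

ℕ→ℚ-* : ∀ a b → ℕ→ℚ (a ℕ.* b) ≡ ℕ→ℚ a * ℕ→ℚ b
ℕ→ℚ-* a b = trans (cong ℤ→ℚ (ℤₚ.pos-* a b)) (ℤ→ℚ-* (ℤ.+ a) (ℤ.+ b))

ℕ→ℚ*inv : ∀ q .{{_ : NonZero q}} → ℕ→ℚ q * inv q ≡ 1ℚ
ℕ→ℚ*inv (suc q) = trans (cong₂ _*_ (ℤ→ℚ≡mkℚ (ℤ.+ suc q)) (ℚₚ.↥p/↧p≡p (mkℚ (ℤ.+ 1) q (Coprimality.1-coprimeTo (suc q)))))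
                        (ℚₚ.*-inverseʳ (mkℚ (ℤ.+ suc q) 0 (Coprimality.sym (Coprimality.1-coprimeTo (suc q)))))

1/inv : ∀ q .{{_ : NonZero q}} → 1/ inv q ≡ ℕ→ℚ q
1/inv q = begin
  1/x                    ≡⟨ ℚₚ.*-identityʳ 1/x ⟨
  1/x * 1ℚ               ≡⟨ cong (1/x *_) (trans (ℚₚ.*-comm (inv q) (ℕ→ℚ q)) (ℕ→ℚ*inv q)) ⟨
  1/x * (inv q * ℕ→ℚ q)  ≡⟨ ℚₚ.*-assoc 1/x _ _ ⟨
  1/x * inv q * ℕ→ℚ q    ≡⟨ cong (_* ℕ→ℚ q) (ℚₚ.*-inverseˡ (inv q)) ⟩
  1ℚ * ℕ→ℚ q             ≡⟨ ℚₚ.*-identityˡ (ℕ→ℚ q) ⟩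
  ℕ→ℚ q                  ∎
  where 1/x = 1/ inv q

module _ (q : ℕ) .{{_ : NonZero q}} where

  q*[y*inv]≡y : ∀ y → ℕ→ℚ q * (y * inv q) ≡ y
  q*[y*inv]≡y y = trans (solve 3 (λ q y x → q :* (y :* x) := y :* (q :* x)) refl (ℕ→ℚ q) y (inv q))
                        (trans (cong (y *_) (ℕ→ℚ*inv q)) (ℚₚ.*-identityʳ y))
    where open ℚ-Solver.+-*-Solver

  invS-ωq : invS (ωq q) ≗ const (ℕ→ℚ q)
  invS-ωq zero    = 1/inv q
  invS-ωq (suc n) = begin
    -- invS unfolds through a private approximant of itself; only its term at k = 0, which is
    -- invS (ωq q) n, survives in the sum, hence ω-tail-Σ is stated for an arbitrary g.
    invS (ωq q) (suc n)               ≡⟨ trans (if-false {n ℕ.<ᵇ n} (n<ᵇn≡false n)) (cong (- (1/ x) *_) (ω-tail-Σ _)) ⟩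
    - (1/ x) * (- x * invS (ωq q) n)  ≡⟨ cong₂ (λ a b → - a * (- x * b)) (1/inv q) (invS-ωq n) ⟩
    - Q * (- x * Q)                   ≡⟨ solve 2 (λ q x → (:- q) :* ((:- x) :* q) := q :* (q :* x)) refl Q x ⟩
    Q * (Q * x)                       ≡⟨ q*[y*inv]≡y Q ⟩
    Q                                 ∎
    where
    open ℚ-Solver.+-*-Solver
    Q x : ℚ
    Q = ℕ→ℚ q
    x = inv q

    if-false : ∀ {b} {t e : ℚ} → b ≡ false → (if b then t else e) ≡ e
    if-false refl = refl

    n<ᵇn≡false : ∀ n → (n ℕ.<ᵇ n) ≡ false
    n<ᵇn≡false zero    = refl
    n<ᵇn≡false (suc n) = n<ᵇn≡false n

    ω-tail-Σ : ∀ (g : ℕ → ℚ) → Σ< (suc n) (λ k → ωq q (suc k) * g k) ≡ - x * g 0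
    ω-tail-Σ g = trans (Σ<-head n (λ k → ωq q (suc k) * g k))
      (trans (cong (λ s → - x * g 0 + s) (Σ<-zeros n (λ i _ → ℚₚ.*-zeroˡ (g (suc i))))) (ℚₚ.+-identityʳ (- x * g 0)))

module _ (m q : ℕ) .{{_ : NonZero q}} where
  private
    Q M x : ℚ
    Q = ℕ→ℚ q
    M = ℕ→ℚ m
    x = inv q

  Tmat-αmq-0-0 : Tmat (αmq m q) (ωq q) 0 0 ≡ M * x
  Tmat-αmq-0-0 = begin
    Tmat (αmq m q) (ωq q) 0 0  ≡⟨ Tmat-0-0 (ωq q) Q (invS-ωq q) (αmq m q) ⟩
    Q * (M * (x * x))          ≡⟨ cong (Q *_) (ℚₚ.*-assoc M x x) ⟨
    Q * (M * x * x)            ≡⟨ q*[y*inv]≡y q (M * x) ⟩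
    M * x                      ∎

  Tmat-αmq-suc-0 : ∀ n → Tmat (αmq m q) (ωq q) (suc n) 0 ≡ 1ℚ
  Tmat-αmq-suc-0 zero = begin
    Tmat (αmq m q) (ωq q) 1 0                      ≡⟨ Tmat-suc-0 (ωq q) Q (invS-ωq q) (αmq m q) 0 ⟩
    Tmat (αmq m q) (ωq q) 0 0 + Q * (D * (x * x))  ≡⟨ cong₂ _+_ Tmat-αmq-0-0 (cong (Q *_) (sym (ℚₚ.*-assoc D x x))) ⟩
    M * x + Q * (D * x * x)                        ≡⟨ cong ((M * x) +_) (q*[y*inv]≡y q (D * x)) ⟩
    M * x + D * x                                  ≡⟨ trans (ℚₚ.+-comm (M * x) (D * x)) (sym (ℚₚ.*-distribʳ-+ x D M)) ⟩
    (D + M) * x                                    ≡⟨ cong (_* x) D+M≡Q ⟩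
    Q * x                                          ≡⟨ ℕ→ℚ*inv q ⟩
    1ℚ                                             ∎
    where
    D = ℤ→ℚ (ℤ.+ q ℤ.- ℤ.+ m)

    D+M≡Q : D + M ≡ Q
    D+M≡Q = trans (sym (ℤ→ℚ-+ (ℤ.+ q ℤ.- ℤ.+ m) (ℤ.+ m))) (cong ℤ→ℚ (begin
      ℤ.+ q ℤ.- ℤ.+ m ℤ.+ ℤ.+ m        ≡⟨ ℤₚ.+-assoc (ℤ.+ q) (ℤ.- ℤ.+ m) (ℤ.+ m) ⟩
      ℤ.+ q ℤ.+ (ℤ.- ℤ.+ m ℤ.+ ℤ.+ m)  ≡⟨ cong (λ z → ℤ.+ q ℤ.+ z) (ℤₚ.+-inverseˡ (ℤ.+ m)) ⟩
      ℤ.+ q ℤ.+ ℤ.+ 0                  ≡⟨ ℤₚ.+-identityʳ (ℤ.+ q) ⟩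
      ℤ.+ q                            ∎))
  Tmat-αmq-suc-0 (suc n) = begin
    Tmat (αmq m q) (ωq q) (suc (suc n)) 0     ≡⟨ Tmat-suc-0 (ωq q) Q (invS-ωq q) (αmq m q) (suc n) ⟩
    Tmat (αmq m q) (ωq q) (suc n) 0 + Q * 0ℚ  ≡⟨ cong₂ _+_ (Tmat-αmq-suc-0 n) (ℚₚ.*-zeroʳ Q) ⟩
    1ℚ + 0ℚ                                   ≡⟨ ℚₚ.+-identityʳ 1ℚ ⟩
    1ℚ                                        ∎

  Ftilde-suc : ∀ n k → Ftilde m q (suc n) k ≡ ℕ→ℚ (faces# (Δ m q n) k)
  Ftilde-suc n k with k ≤ᵇ suc n in k≤ᵇ1+n
  ... | true  = refl
  ... | false = cong ℕ→ℚ (sym (faces#-Δ-vanish m q n k (ℕₚ.≰⇒> (λ k≤1+n → subst T k≤ᵇ1+n (ℕₚ.≤⇒≤ᵇ k≤1+n)))))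

  Ftilde-suc-0 : ∀ n → Ftilde m q (suc n) 0 ≡ 1ℚ
  Ftilde-suc-0 n = cong ℕ→ℚ (faces#-Δ-0 m q n)

  Ftilde-pascal : PascalRecurrence Q (Ftilde m q)
  Ftilde-pascal zero zero    = trans (cong ℕ→ℚ (faces#-Δ₀-1 m q)) (sym (trans (ℚₚ.+-identityˡ _) (q*[y*inv]≡y q M)))
  Ftilde-pascal zero (suc k) = sym (trans (ℚₚ.+-identityˡ _) (ℚₚ.*-zeroʳ Q))
  Ftilde-pascal (suc n) k = begin
    Ftilde m q (suc (suc n)) (suc k)                       ≡⟨ Ftilde-suc (suc n) (suc k) ⟩
    ℕ→ℚ (faces# (Δ m q (suc n)) (suc k))                   ≡⟨ cong ℕ→ℚ (faces#-Δ-suc m q n k) ⟩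
    ℕ→ℚ (f₊ ℕ.+ q ℕ.* f)                                   ≡⟨ trans (ℕ→ℚ-+ f₊ (q ℕ.* f)) (cong (ℕ→ℚ f₊ +_) (ℕ→ℚ-* q f)) ⟩
    ℕ→ℚ f₊ + Q * ℕ→ℚ f                                     ≡⟨ cong₂ (λ a b → a + Q * b) (Ftilde-suc n (suc k)) (Ftilde-suc n k) ⟨
    Ftilde m q (suc n) (suc k) + Q * Ftilde m q (suc n) k  ∎
    where
    f₊ = faces# (Δ m q n) (suc k)
    f  = faces# (Δ m q n) k

corollary5p3 : (m q : ℕ) → .{{_ : NonZero m}} → .{{_ : NonZero q}} →
    (n k : ℕ) →
    Ftilde m q n k ≡ Tmat (αmq m q) (ωq q) {{inv-nonZero q}} n k
corollary5p3 m q = pascal-unique {ℕ→ℚ q} (Ftilde-pascal m q) (Tmat-pascal (ωq q) (ℕ→ℚ q) (invS-ωq q) (αmq m q))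
                                  row₀ column₀
  where
  row₀ : ∀ k → Ftilde m q 0 k ≡ Tmat (αmq m q) (ωq q) 0 k
  row₀ zero    = sym (Tmat-αmq-0-0 m q)
  row₀ (suc k) = sym (Tmat-0-suc (ωq q) (ℕ→ℚ q) (invS-ωq q) (αmq m q) k)

  column₀ : ∀ n → Ftilde m q (suc n) 0 ≡ Tmat (αmq m q) (ωq q) (suc n) 0
  column₀ n = trans (Ftilde-suc-0 m q n) (sym (Tmat-αmq-suc-0 m q n))
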